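{- Let $\mathcal E: q\mapsto\phi_q$ ($q\in Q$) be a modalised system of equations, and let $\mathcal F$ be the substitution $q\mapsto\digamma_{\!q}\,\mathcal E$ ($q\in Q$). Then $\mathcal F$ is a solution of $\mathcal E$: for each $q\in Q$, $\digamma_{\!q}\,\mathcal E\simeq\phi_q\mathcal F$, and no variable of $Q$ occurs in any $\digamma_{\!q}\,\mathcal E$.
   Context: Cyclic formulas. Labels: $\bot,\top$ and propositional variables (arity 0), $\neg,\Box$ (arity 1), $\wedge,\vee,\to$ (arity 2). A graph is $\langle V,r,S,\lambda\rangle$ with $V$ finite, root $r$, labelling $\lambda$, and $S:V\to V^{*}$ giving ordered successors (length = arity of label); every vertex reachable from $r$. A cycle is a set of pairwise distinct vertices $a_0,\dots,a_{k-1}$ with $a_{j+1}$ a successor of $a_j$ and $a_0$ a successor of $a_{k-1}$. A formula is a graph in which every cycle contains a $\Box$-labelled vertex. Bisimulation $R$: $aRa'$ implies equal labels and $i$-th successors related; $\phi\simeq\psi$ iff a bisimulation relates roots. $\langle\Psi\rangle_a$ is the subgraph generated by $a$. Simultaneous substitution $\phi\mathcal F$: disjoint union of $\phi$ and the $\mathcal F(q)$, identifying each $q$-labelled vertex of $\phi$ with the root of the copy of $\mathcal F(q)$ (keeping that root's label). $\phi$ is modalised in $p$ if every path from root to a $p$-labelled vertex contains a $\Box$-labelled vertex. A system of equations $\mathcal E$ maps a finite set $Q$ of variables to formulas $\phi_q$. ${\sf G}_{\mathcal E}$: directed graph on $Q$ with $q\to q'$ iff $\phi_q$ not modalised in $q'$;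 $\mathcal E$ is modalised iff ${\sf G}_{\mathcal E}$ is acyclic. ${\sf G}^\circ_{\mathcal E}$: $q\to q'$ iff the root of $\phi_q$ is labelled $q'$; ${\sf end}(q)$ = endpoint of the maximal path from $q$ in ${\sf G}^\circ_{\mathcal E}$. Unrooted graph $\Psi$: vertices $\langle\phi_q,a\rangle$ for $q\in Q$ and $a$ a vertex of $\phi_q$ whose label is not in $Q$; label $\lambda_{\phi_q}(a)$; ${\sf idfy}\langle\phi_q,a\rangle:=\langle\phi_{{\sf end}(q')},r_{\phi_{{\sf end}(q')}}\rangle$ if $a$ is labelled $q'\in Q$, else $\langle\phi_q,a\rangle$; if $S_{\phi_q}a=\langle b_0,\dots,b_{n-1}\rangle$ then $S_\Psi\langle\phi_q,a\rangle:=\langle{\sf idfy}\langle\phi_q,b_0\rangle,\dots,{\sf idfy}\langle\phi_q,b_{n-1}\rangle\rangle$; $\mathfrak r_q:={\sf idfy}\langle\phi_q,r_{\phi_q}\rangle$; $\digamma_{\!q}\,\mathcal E:=\langle\Psi\rangle_{\mathfrak r_q}$. -}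

module Defs where

open import Data.Nat using (ℕ; zero; suc; _≟_)
open import Data.Fin using (Fin; zero; suc; inject₁; fromℕ)
open import Data.Vec using (Vec; lookup; map)
open import Data.List using (List)
open import Data.List.Membership.Propositional using (_∈_)
open import Data.List.Membership.DecPropositional _≟_ using (_∈?_)
open import Data.List.Relation.Unary.Unique.Propositional using (Unique)
open import Data.Product using (Σ; ∃; _×_; _,_; proj₁; proj₂)
open import Data.Sum using (_⊎_; inj₁; inj₂)
open import Data.Empty using (⊥; ⊥-elim)
open import Relation.Nullary using (¬_; yes; no)
open import Relation.Binary.PropositionalEquality using (_≡_; refl; subst)
open import Relation.Binary.Construct.Closure.ReflexiveTransitive using (Star)
open import Function using (Injective)
open import Function.Bundles using (_↔_)

data Label : Set where
  botₗ topₗ : Label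
  var       : ℕ → Label
  negₗ boxₗ : Label
  andₗ orₗ impₗ : Label

arity : Label → ℕ
arity botₗ    = 0
arity topₗ    = 0
arity (var _) = 0
arity negₗ    = 1
arity boxₗ    = 1
arity andₗ    = 2
arity orₗ     = 2
arity impₗ    = 2

record UGraph : Set₁ where
  field
    V    : Set
    lab  : V → Label
    succ : (v : V) → Vec V (arity (lab v))

record Graph : Set₁ where
  field
    ug   : UGraph
  open UGraph ug public
  field
    root : V

open UGraph
open Graph

Edge : (G : UGraph) → V G → V G → Set
Edge G a b = Σ (Fin (arity (lab G a))) λ i → lookup (succ G a) i ≡ b

data Path (G : UGraph) (a : V G) : V G → Set where
  here : Path G a a
  step : ∀ {b} → Path G a b → (i : Fin (arity (lab G b))) →
         Path G a (lookup (succ G b) i)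

HasBox : (G : UGraph) {a b : V G} → Path G a b → Set
HasBox G {a} here = lab G a ≡ boxₗ
HasBox G (step {b} π i) = HasBox G π ⊎ lab G (lookup (succ G b) i) ≡ boxₗ

record Cycle {A : Set} (_⇒_ : A → A → Set) : Set where
  field
    len   : ℕ
    vs    : Fin (suc len) → A
    inj   : Injective _≡_ _≡_ vs
    edges : (j : Fin len) → vs (inject₁ j) ⇒ vs (suc j)
    close : vs (fromℕ len) ⇒ vs zero

record Formula : Set₁ where
  field
    graph  : Graph
    finite : Σ ℕ λ n → V graph ↔ Fin n
    reach  : ∀ v → Path (ug graph) (root graph) v
    boxed  : (c : Cycle (Edge (ug graph))) →
             ∃ λ j → lab graph (Cycle.vs c j) ≡ boxₗ

open Formula

IsBisim : (G H : Graph) → (V G → V H → Set) → Set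
IsBisim G H R = ∀ a a' → R a a' →
  Σ (lab G a ≡ lab H a') λ e → ∀ (i : Fin (arity (lab G a))) →
    R (lookup (succ G a) i) (lookup (succ H a') (subst (λ l → Fin (arity l)) e i))

_≃_ : Graph → Graph → Set₁
G ≃ H = Σ (V G → V H → Set) λ R → IsBisim G H R × R (root G) (root H)

record GenV (Ψ : UGraph) (a : V Ψ) : Set where
  constructor gv
  field
    vtx    : V Ψ
    .reach : Path Ψ a vtx

genSucc : {Ψ : UGraph} {a : V Ψ} (w : GenV Ψ a) →
          Vec (GenV Ψ a) (arity (lab Ψ (GenV.vtx w)))
genSucc {Ψ} (gv v r) = Data.Vec.tabulate λ i → gv (lookup (succ Ψ v) i) (step r i)

⟨_⟩_ : (Ψ : UGraph) → V Ψ → Graph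
⟨ Ψ ⟩ a = record
  { ug = record
    { V    = GenV Ψ a
    ; lab  = λ w → lab Ψ (GenV.vtx w)
    ; succ = genSucc
    }
  ; root = gv a here
  }

Modalised : Graph → ℕ → Set
Modalised φ p = ∀ v → lab φ v ≡ var p → (π : Path (ug φ) (root φ) v) → HasBox (ug φ) π

-- Variables from a finite set Q (a duplicate-free list)

InQ : List ℕ → Label → Set
InQ Q (var x) = x ∈ Q
InQ Q _       = ⊥

QT : List ℕ → Set
QT Q = Σ ℕ λ q → q ∈ Q

classify : (Q : List ℕ) (l : Label) → (Σ (QT Q) λ q → l ≡ var (proj₁ q)) ⊎ ¬ InQ Q l
classify Q (var x) with x ∈? Q
... | yes p = inj₁ ((x , p) , refl)
... | no np = inj₂ np
classify Q botₗ = inj₂ λ ()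
classify Q topₗ = inj₂ λ ()
classify Q negₗ = inj₂ λ ()
classify Q boxₗ = inj₂ λ ()
classify Q andₗ = inj₂ λ ()
classify Q orₗ  = inj₂ λ ()
classify Q impₗ = inj₂ λ ()

-- Simultaneous substitution φ𝓕 (𝓕 : Q → graphs): disjoint union of φ and
-- the 𝓕(q), each q-labelled vertex of φ identified with the root of 𝓕(q).

module _ (Q : List ℕ) (φ : Graph) (F : QT Q → Graph) where

  SubV : Set
  SubV = (Σ (V φ) λ v → ¬ InQ Q (lab φ v)) ⊎ (Σ (QT Q) λ q → V (F q))

  sidfy : V φ → SubV
  sidfy b with classify Q (lab φ b)
  ... | inj₁ (q , _) = inj₂ (q , root (F q))
  ... | inj₂ n       = inj₁ (b , n)

  subLab : SubV → Label
  subLab (inj₁ (v , _)) = lab φ v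
  subLab (inj₂ (q , w)) = lab (F q) w

  subSucc : (x : SubV) → Vec SubV (arity (subLab x))
  subSucc (inj₁ (v , _)) = map sidfy (succ φ v)
  subSucc (inj₂ (q , w)) = map (λ w' → inj₂ (q , w')) (succ (F q) w)

  substG : Graph
  substG = record
    { ug = record { V = SubV ; lab = subLab ; succ = subSucc }
    ; root = sidfy (root φ) }

record System : Set₁ where
  field
    Q    : List ℕ
    uniq : Unique Q
    eqn  : QT Q → Formula

module _ (E : System) where
  open System E

  φ : QT Q → Graph
  φ q = graph (eqn q)

  GEdge : QT Q → QT Q → Set
  GEdge q q' = ¬ Modalised (φ q) (proj₁ q')

  ModalisedSystem : Set
  ModalisedSystem = ¬ Cycle GEdge

  G∘Edge : QT Q → QT Q → Set
  G∘Edge q q' = lab (φ q) (root (φ q)) ≡ var (proj₁ q')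

  IsEnd : QT Q → QT Q → Set
  IsEnd q e = Star G∘Edge q e × (∀ q' → ¬ G∘Edge e q')

  EndFun : Set
  EndFun = Σ (QT Q → QT Q) λ en → ∀ q → IsEnd q (en q)

  module _ (en : EndFun) where
    end : QT Q → QT Q
    end = proj₁ en

    endRootNotQ : ∀ q → ¬ InQ Q (lab (φ (end q)) (root (φ (end q))))
    endRootNotQ q with classify Q (lab (φ (end q)) (root (φ (end q))))
    ... | inj₁ (q' , e) = λ _ → proj₂ (proj₂ en q) q' e
    ... | inj₂ n = n

    ΨV : Set
    ΨV = Σ (QT Q) λ q → Σ (V (φ q)) λ a → ¬ InQ Q (lab (φ q) a)

    idfy : (q : QT Q) → V (φ q) → ΨV
    idfy q b with classify Q (lab (φ q) b)
    ... | inj₁ (q' , _) = end q' , root (φ (end q')) , endRootNotQ q'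
    ... | inj₂ n        = q , b , n

    Ψ : UGraph
    Ψ = record
      { V    = ΨV
      ; lab  = λ { (q , a , _) → lab (φ q) a }
      ; succ = λ { (q , a , _) → map (idfy q) (succ (φ q) a) }
      }

    𝔯 : QT Q → ΨV
    𝔯 q = idfy q (root (φ q))

    digamma : QT Q → Graph
    digamma q = ⟨ Ψ ⟩ 𝔯 q

module Submission where

-- A variable labelling the root of φ_q is reached by the empty path, which
-- contains no □; so every edge of G°_𝓔 is an edge of G_𝓔 and G°_𝓔 is acyclic.
-- It is also functional and Q is finite, hence following it from any q
-- reaches a unique end(q) whose equation does not start with a variable of Q.
--
-- Every vertex of φ_q𝓕 denotes a vertex of Ψ: either a vertex of φ_q whose
-- label is not in Q, or a vertex of some ϝ_q′𝓔 ⊆ Ψ.  A q′-labelled vertex of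
-- φ_q is glued to the root of ϝ_q′𝓔, which is 𝔯_q′, the root of φ_end(q′),
-- exactly where idfy sends it in Ψ.  So "denoting the same vertex of Ψ" is a
-- bisimulation between ϝ_q𝓔 and φ_q𝓕, and Ψ has no Q-labelled vertices.

open import Defs
open import Data.Product using (_×_)
open import Relation.Nullary using (¬_)

open import Data.Nat using (ℕ; zero; suc; _≤_; _+_)
open import Data.Nat.Properties using (≤-refl; ≤-trans; +-suc; +-identityʳ; 1+n≰n)
open import Data.Fin using (Fin; zero; suc; inject₁; fromℕ)
import Data.Fin as Fin
open import Data.Fin.Properties using (any?; injective⇒≤; suc-injective)
open import Data.Fin.Relation.Unary.Top using (View; view; ‵fromℕ; ‵inj₁; view-fromℕ; view-inject₁)
open import Data.Vec using (lookup; map)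
open import Data.Vec.Properties using (lookup-map; lookup∘tabulate)
import Data.List as List
open import Data.List.Relation.Unary.Any using (index)
open import Data.List.Relation.Unary.Any.Properties using (lookup-index)
open import Data.List.Membership.Propositional.Properties.WithK using (unique⇒irrelevant)
open import Data.Product using (Σ; ∃; _,_; proj₁; proj₂)
open import Data.Sum using (inj₁; inj₂)
open import Relation.Nullary using (Dec; yes; no; contradiction)
open import Relation.Nullary.Decidable using (map′)
open import Relation.Binary.Definitions using (DecidableEquality)
open import Relation.Binary.PropositionalEquality
open import Relation.Binary.Construct.Closure.ReflexiveTransitive using (Star; ε; _◅_)
open import Relation.Binary.Rewriting
  using (IsNormalForm; HasNormalForm; WeaklyNormalizing; Deterministic; det⇒conf)
open import Function using (Injective; _∘_)

open UGraph
open Graph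

module _ {A : Set} where

  snoc : ∀ {k} → (Fin (suc k) → A) → A → Fin (suc (suc k)) → A
  snoc f a i with view i
  ... | ‵fromℕ         = a
  ... | ‵inj₁ {i = j} _ = f j

  snoc-inject₁ : ∀ {k} (f : Fin (suc k) → A) a j → snoc f a (inject₁ j) ≡ f j
  snoc-inject₁ f a j rewrite view-inject₁ j = refl

  snoc-fromℕ : ∀ {k} (f : Fin (suc k) → A) a → snoc f a (fromℕ (suc k)) ≡ a
  snoc-fromℕ {k} f a rewrite view-fromℕ (suc k) = refl

  snoc-injective : ∀ {k} {f : Fin (suc k) → A} {a} →
    Injective _≡_ _≡_ f → (∀ i → f i ≢ a) → Injective _≡_ _≡_ (snoc f a)
  snoc-injective f-inj fresh {x} {y} eq with view x | view y
  ... | ‵fromℕ         | ‵fromℕ         = refl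
  ... | ‵inj₁ {i = i} _ | ‵inj₁ {i = j} _ = cong inject₁ (f-inj eq)
  ... | ‵inj₁ {i = i} _ | ‵fromℕ         = contradiction eq (fresh i)
  ... | ‵fromℕ         | ‵inj₁ {i = j} _ = contradiction (sym eq) (fresh j)

module _ {A : Set} (_⇒_ : A → A → Set) where

  record SimplePath (k : ℕ) : Set where
    field
      vs    : Fin (suc k) → A
      inj   : Injective _≡_ _≡_ vs
      edges : (j : Fin k) → vs (inject₁ j) ⇒ vs (suc j)

    last : A
    last = vs (fromℕ k)

  open SimplePath

  singleton : A → SimplePath 0
  singleton a = record { vs = λ _ → a ; inj = λ { {zero} {zero} _ → refl } ; edges = λ () }

  extend : ∀ {k} (p : SimplePath k) {b} → last p ⇒ b → (∀ i → vs p i ≢ b) → SimplePath (suc k)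
  extend p {b} e fresh = record
    { vs    = snoc (vs p) b
    ; inj   = snoc-injective (inj p) fresh
    ; edges = edges′
    }
    where
    edges′ : ∀ j → snoc (vs p) b (inject₁ j) ⇒ snoc (vs p) b (suc j)
    edges′ j = from-view (view j)
      where
      from-view : ∀ {j} → View j → snoc (vs p) b (inject₁ j) ⇒ snoc (vs p) b (suc j)
      from-view ‵fromℕ =
        subst₂ _⇒_ (sym (snoc-inject₁ (vs p) b _)) (sym (snoc-fromℕ (vs p) b)) e
      from-view (‵inj₁ {i = i} _) =
        subst₂ _⇒_ (sym (snoc-inject₁ (vs p) b (inject₁ i))) (sym (snoc-inject₁ (vs p) b (suc i)))
          (edges p i)

  tail : ∀ {k} → SimplePath (suc k) → SimplePath k
  tail p = record
    { vs    = vs p ∘ suc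
    ; inj   = λ eq → suc-injective (inj p eq)
    ; edges = edges p ∘ suc
    }

  toCycle : ∀ {k} (p : SimplePath k) (m : Fin (suc k)) → last p ⇒ vs p m → Cycle _⇒_
  toCycle {k} p zero e = record { len = k ; vs = vs p ; inj = inj p ; edges = edges p ; close = e }
  toCycle {suc k} p (suc m) e = toCycle (tail p) m e

Cycle-map : ∀ {A : Set} {R S : A → A → Set} → (∀ {a b} → R a b → S a b) → Cycle R → Cycle S
Cycle-map R⊆S c = record
  { len = len ; vs = vs ; inj = inj ; edges = λ j → R⊆S (edges j) ; close = R⊆S close }
  where open Cycle c

normalForm-unique : ∀ {A : Set} {_⇒_ : A → A → Set} → Deterministic _≡_ _⇒_ →
  ∀ {a b c} → Star _⇒_ a b → IsNormalForm _⇒_ b → Star _⇒_ a c → IsNormalForm _⇒_ c → b ≡ c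
normalForm-unique det a↠b b-nf a↠c c-nf with det⇒conf det a↠b a↠c
... | _ , ε     , ε     = refl
... | _ , s ◅ _ , _     = contradiction (_ , s) b-nf
... | _ , ε     , s ◅ _ = contradiction (_ , s) c-nf

module _ {A : Set} {n : ℕ} {_⇒_ : A → A → Set}
         (ι : A → Fin n) (ι-injective : Injective _≡_ _≡_ ι)
         (acyclic : ¬ Cycle _⇒_) (normal? : ∀ a → Dec (∃ λ b → a ⇒ b)) where

  open SimplePath

  private
    _≟_ : DecidableEquality A
    a ≟ b = map′ ι-injective (cong ι) (ι a Fin.≟ ι b)

    -- A simple path has at most n vertices, so it can be extended at most n times.
    walk : ∀ fuel {k} → n ≤ k + fuel → (p : SimplePath _⇒_ k) → HasNormalForm _⇒_ (last p)
    walk zero {k} bound p = contradiction (≤-trans k+1≤n (subst (n ≤_) (+-identityʳ k) bound)) 1+n≰n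
      where
      k+1≤n : suc k ≤ n
      k+1≤n = injective⇒≤ (λ eq → inj p (ι-injective eq))
    walk (suc fuel) {k} bound p with normal? (last p)
    ... | no nf = last p , nf , ε
    ... | yes (b , e) with any? (λ m → vs p m ≟ b)
    ...   | yes (m , refl) = contradiction (toCycle _⇒_ p m e) acyclic
    ...   | no old
      with walk fuel (subst (n ≤_) (+-suc k fuel) bound) (extend _⇒_ p e λ i eq → old (i , eq))
    ...     | c , c-nf , b↠c = c , c-nf , e ◅ subst (λ x → Star _⇒_ x c) (snoc-fromℕ (vs p) b) b↠c

  acyclic⇒weaklyNormalizing : WeaklyNormalizing _⇒_
  acyclic⇒weaklyNormalizing a = walk n ≤-refl (singleton _⇒_ a)

var-injective : ∀ {x y} → var x ≡ var y → x ≡ y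
var-injective refl = refl

⟨⟩-succ : ∀ {Ψ : UGraph} {a} (w : GenV Ψ a) i →
  GenV.vtx (lookup (genSucc w) i) ≡ lookup (succ Ψ (GenV.vtx w)) i
⟨⟩-succ (gv v _) i = cong GenV.vtx (lookup∘tabulate _ i)

module _ (E : System) where
  open System E

  QT-≡ : {q q′ : QT Q} → proj₁ q ≡ proj₁ q′ → q ≡ q′
  QT-≡ {x , x∈Q} {.x , x∈Q′} refl = cong (x ,_) (unique⇒irrelevant uniq x∈Q x∈Q′)

  index-injective : Injective _≡_ _≡_ (λ (q : QT Q) → index (proj₂ q))
  index-injective {_ , x∈Q} {_ , y∈Q} eq =
    QT-≡ (trans (lookup-index x∈Q) (trans (cong (List.lookup Q) eq) (sym (lookup-index y∈Q))))

  G∘-deterministic : Deterministic _≡_ (G∘Edge E)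
  G∘-deterministic s s′ = QT-≡ (var-injective (trans (sym s) s′))

  G∘⊆G : ∀ {q q′} → G∘Edge E q q′ → GEdge E q q′
  G∘⊆G {q} s modalised with trans (sym s) (modalised (root (φ E q)) s here)
  ... | ()

  rootNotInQ⇒normal : ∀ {q} → ¬ InQ Q (lab (φ E q) (root (φ E q))) → IsNormalForm (G∘Edge E) q
  rootNotInQ⇒normal notQ (q′ , s) = notQ (subst (InQ Q) (sym s) (proj₂ q′))

  G∘-successor? : ∀ q → Dec (∃ λ q′ → G∘Edge E q q′)
  G∘-successor? q with classify Q (lab (φ E q) (root (φ E q)))
  ... | inj₁ (q′ , s) = yes (q′ , s)
  ... | inj₂ notQ     = no (rootNotInQ⇒normal notQ)

  endFun : ModalisedSystem E → EndFun E
  endFun modalised = proj₁ ∘ normalize , isEnd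
    where
    normalize : WeaklyNormalizing (G∘Edge E)
    normalize = acyclic⇒weaklyNormalizing (λ q → index (proj₂ q)) index-injective
                  (λ c → modalised (Cycle-map (λ {q} {q′} → G∘⊆G {q} {q′}) c)) G∘-successor?

    isEnd : ∀ q → IsEnd E q (proj₁ (normalize q))
    isEnd q = let (_ , e-nf , q↠e) = normalize q in q↠e , λ q′ s → e-nf (q′ , s)

  module _ (en : EndFun E) where

    end-reachable : ∀ q → Star (G∘Edge E) q (end E en q)
    end-reachable q = proj₁ (proj₂ en q)

    end-normal : ∀ q → IsNormalForm (G∘Edge E) (end E en q)
    end-normal q (q′ , s) = proj₂ (proj₂ en q) q′ s

    end-of-normal : ∀ {q} → IsNormalForm (G∘Edge E) q → end E en q ≡ q
    end-of-normal {q} q-nf = normalForm-unique G∘-deterministic (end-reachable q) (end-normal q) ε q-nf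

    end-step : ∀ {q q′} → G∘Edge E q q′ → end E en q ≡ end E en q′
    end-step {q} {q′} s =
      normalForm-unique G∘-deterministic
        (end-reachable q) (end-normal q) (s ◅ end-reachable q′) (end-normal q′)

    Position : Set
    Position = Σ (QT Q) λ q → V (φ E q)

    position : ΨV E en → Position
    position (q , a , _) = q , a

    labelAt : Position → Label
    labelAt (q , a) = lab (φ E q) a

    -- Ψ-vertices carry a proof that their label is not in Q; such proofs
    -- cannot be identified without function extensionality.
    _≈_ : ΨV E en → ΨV E en → Set
    x ≈ y = position x ≡ position y

    position-𝔯 : ∀ q → position (𝔯 E en q) ≡ (end E en q , root (φ E (end E en q)))
    position-𝔯 q with classify Q (lab (φ E q) (root (φ E q)))
    ... | inj₁ (q′ , s) = cong (λ e → e , root (φ E e)) (sym (end-step s))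
    ... | inj₂ notQ     = cong (λ e → e , root (φ E e)) (sym (end-of-normal (rootNotInQ⇒normal notQ)))

    succ-≈ : ∀ x y (x≈y : x ≈ y) i →
      lookup (succ (Ψ E en) x) i ≈
      lookup (succ (Ψ E en) y) (subst (λ l → Fin (arity l)) (cong labelAt x≈y) i)
    succ-≈ (_ , _ , _) (_ , _ , _) refl i = refl

    module _ (q : QT Q) where

      H : Graph
      H = substG Q (φ E q) (digamma E en)

      embed : V H → ΨV E en
      embed (inj₁ (v , notQ)) = q , v , notQ
      embed (inj₂ (_ , w))    = GenV.vtx w

      embed-sidfy : ∀ b → embed (sidfy Q (φ E q) (digamma E en) b) ≈ idfy E en q b
      embed-sidfy b with classify Q (lab (φ E q) b)
      ... | inj₁ (q′ , _) = position-𝔯 q′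
      ... | inj₂ _        = refl

      embed-succ-φ : ∀ v notQ i →
        embed (lookup (succ H (inj₁ (v , notQ))) i) ≈ lookup (succ (Ψ E en) (q , v , notQ)) i
      embed-succ-φ v _ i = begin
        position (embed (lookup (map (sidfy Q (φ E q) (digamma E en)) (succ (φ E q) v)) i))
          ≡⟨ cong (position ∘ embed) (lookup-map i _ (succ (φ E q) v)) ⟩
        position (embed (sidfy Q (φ E q) (digamma E en) (lookup (succ (φ E q) v) i)))
          ≡⟨ embed-sidfy (lookup (succ (φ E q) v) i) ⟩
        position (idfy E en q (lookup (succ (φ E q) v) i))
          ≡⟨ cong position (lookup-map i _ (succ (φ E q) v)) ⟨
        position (lookup (map (idfy E en q) (succ (φ E q) v)) i)
          ∎
        where open ≡-Reasoning

      embed-succ-digamma : ∀ q′ w i →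
        embed (lookup (succ H (inj₂ (q′ , w))) i) ≈ lookup (succ (Ψ E en) (GenV.vtx w)) i
      embed-succ-digamma _ w i =
        cong position (trans (cong embed (lookup-map i _ (genSucc w))) (⟨⟩-succ w i))

      embed-bisim : IsBisim (digamma E en q) H (λ x y → GenV.vtx x ≈ embed y)
      -- The clauses agree; splitting on y is what makes the label of y in H compute.
      embed-bisim x (inj₁ (v , notQ)) x≈y = cong labelAt x≈y , λ i →
        trans (cong position (⟨⟩-succ x i))
          (trans (succ-≈ (GenV.vtx x) (q , v , notQ) x≈y i) (sym (embed-succ-φ v notQ _)))
      embed-bisim x (inj₂ (q′ , w)) x≈y = cong labelAt x≈y , λ i →
        trans (cong position (⟨⟩-succ x i))
          (trans (succ-≈ (GenV.vtx x) (GenV.vtx w) x≈y i) (sym (embed-succ-digamma q′ w _)))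

      digamma-solves : digamma E en q ≃ H
      digamma-solves = _ , embed-bisim , sym (embed-sidfy (root (φ E q)))

      digamma-Q-free : ∀ v → ¬ InQ Q (lab (digamma E en q) v)
      digamma-Q-free v = proj₂ (proj₂ (GenV.vtx v))

theorem2p15 : (E : System) → ModalisedSystem E →
    EndFun E ×
    ((en : EndFun E) → ∀ q →
      (digamma E en q ≃ substG (System.Q E) (φ E q) (digamma E en))
      × (∀ v → ¬ InQ (System.Q E) (Graph.lab (digamma E en q) v)))
theorem2p15 E modalised = endFun E modalised , λ en q → digamma-solves E en q , digamma-Q-free E en q
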